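{- Let $p$ be an odd prime. The solutions in non-negative integers $x,y,z$ of the Diophantine equation $$16^{x}+p^{y}=z^{2}$$ are given in the following two cases: Case 1. For $p=3$: $(x,y,z)=(1,2,5)$. Case 2. For $p=1+2^{2k+1}$, where $k$ is a non-negative integer: $(x,y,z)=(k,1,2^{2k}+1)$. -}

{-# OPTIONS --safe #-}

-- With a = 2^(2x) the equation reads (z − a)(z + a) = p^y, so both factors are powers of p;
-- their difference 2a is prime to p, hence z − a = 1 and p^y = 1 + 2^(2x+1). The right-hand side
-- is divisible by 3, so p = 3 (in particular 1 + 2^(2k+1) is prime only for k = 0). Finally, if
-- x ≥ 2 then 3^y ≡ 1 (mod 16) forces 4 ∣ y, so 3^y ≡ 1 (mod 5) and 5 would divide 2^(2x+1).

module Submission where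

open import Data.Nat using (ℕ; zero; suc; _+_; _*_; _^_; _∸_; _≤_; _<_; z≤n; s≤s; NonZero; _%_; _/_)
open import Data.Nat.Properties
open import Data.Nat.Divisibility
  using (_∣_; divides; _∣?_; _∣0; ∣1⇒≡1; ∣-refl; ∣m∣n⇒∣m+n; ∣m+n∣m⇒∣n; m∣m*n)
open import Data.Nat.DivMod using (m≡m%n+[m/n]*n; [m+kn]%n≡m%n; %-distribˡ-*; m%n<n)
open import Data.Nat.Primality
  using (Prime; ¬prime[1]; prime[2]; prime⇒irreducible; prime⇒nonZero; prime?)
open import Data.Nat.Coprimality using (Coprime; coprime-divisor)
open import Data.Nat.Tactic.RingSolver using (solve-∀)
open import Data.Product using (_×_; ∃-syntax; _,_)
open import Data.Sum using (_⊎_; inj₁; inj₂)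
open import Relation.Nullary using (¬_; yes; no; contradiction)
open import Relation.Nullary.Decidable using (from-yes)
open import Relation.Binary.Definitions using (tri<; tri≈; tri>)
open import Relation.Binary.PropositionalEquality
  using (_≡_; _≢_; refl; sym; trans; cong; cong₂; subst; module ≡-Reasoning)
open import Function.Bundles using (_⇔_; mk⇔)

open ≡-Reasoning

∣prime^⇒≡1⊎prime∣ : ∀ {p d} n → Prime p → d ∣ p ^ n → d ≡ 1 ⊎ p ∣ d
∣prime^⇒≡1⊎prime∣ zero _ d∣1 = inj₁ (∣1⇒≡1 d∣1)
∣prime^⇒≡1⊎prime∣ {p} {d} (suc n) pp d∣p^[1+n] with p ∣? d
... | yes p∣d = inj₂ p∣d
... | no p∤d = ∣prime^⇒≡1⊎prime∣ n pp (coprime-divisor d⊥p d∣p^[1+n])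
  where
  d⊥p : Coprime d p
  d⊥p {c} (c∣d , c∣p) with prime⇒irreducible pp c∣p
  ... | inj₁ c≡1 = c≡1
  ... | inj₂ refl = contradiction c∣d p∤d

prime∣prime^⇒≡ : ∀ {p q} n → Prime p → Prime q → q ∣ p ^ n → q ≡ p
prime∣prime^⇒≡ n pp pq q∣p^n with ∣prime^⇒≡1⊎prime∣ n pp q∣p^n
... | inj₁ refl = contradiction pq ¬prime[1]
... | inj₂ p∣q with prime⇒irreducible pq p∣q
...   | inj₁ refl = contradiction pp ¬prime[1]
...   | inj₂ p≡q = sym p≡q

prime[3] : Prime 3
prime[3] = from-yes (prime? 3)

prime[5] : Prime 5
prime[5] = from-yes (prime? 5)

a²+p^y≡z²⇒z≡1+a : ∀ {p} a y z → Prime p → ¬ (p ∣ 2 * a) → a * a + p ^ y ≡ z * z → z ≡ 1 + a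
a²+p^y≡z²⇒z≡1+a zero _ _ _ p∤0 _ = contradiction (_ ∣0) p∤0
a²+p^y≡z²⇒z≡1+a {p} a@(suc _) y z pp p∤2a eq = begin
  z      ≡⟨ a+u≡z ⟨
  a + u  ≡⟨ +-comm a u ⟩
  u + a  ≡⟨ cong (_+ a) u≡1 ⟩
  1 + a  ∎
  where
  instance
    p≢0 : NonZero p
    p≢0 = prime⇒nonZero pp
  a<z : a < z
  a<z = ≰⇒> λ z≤a → <⇒≱ (subst (a * a <_) eq (m<m+n (a * a) (m^n>0 p y))) (*-mono-≤ z≤a z≤a)
  u = z ∸ a
  v = u + 2 * a
  a+u≡z : a + u ≡ z
  a+u≡z = m+[n∸m]≡n (<⇒≤ a<z)
  expand : ∀ a u → a * a + u * (u + 2 * a) ≡ (a + u) * (a + u)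
  expand = solve-∀
  uv≡p^y : u * v ≡ p ^ y
  uv≡p^y = +-cancelˡ-≡ (a * a) _ _ (begin
    a * a + u * v        ≡⟨ expand a u ⟩
    (a + u) * (a + u)    ≡⟨ cong (λ t → t * t) a+u≡z ⟩
    z * z                ≡⟨ eq ⟨
    a * a + p ^ y        ∎)
  2≤v : 2 ≤ v
  2≤v = ≤-trans (*-monoʳ-≤ 2 (s≤s z≤n)) (m≤n+m (2 * a) u)
  u≡1 : u ≡ 1
  u≡1 with ∣prime^⇒≡1⊎prime∣ y pp (divides v (trans (sym uv≡p^y) (*-comm u v)))
         | ∣prime^⇒≡1⊎prime∣ y pp (divides u (sym uv≡p^y))
  ... | inj₁ u≡1 | _        = u≡1
  ... | inj₂ _   | inj₁ v≡1 = contradiction (subst (2 ≤_) v≡1 2≤v) λ { (s≤s ()) }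
  ... | inj₂ p∣u | inj₂ p∣v = contradiction (∣m+n∣m⇒∣n p∣v p∣u) p∤2a

16^n≡2^[2n]*2^[2n] : ∀ n → 16 ^ n ≡ 2 ^ (2 * n) * 2 ^ (2 * n)
16^n≡2^[2n]*2^[2n] n = trans (^-*-assoc 2 4 n) (trans (cong (2 ^_) (double n)) (^-distribˡ-+-* 2 (2 * n) (2 * n)))
  where
  double : ∀ n → 4 * n ≡ 2 * n + 2 * n
  double = solve-∀

16^x+p^y≡z²⇒z≡1+2^[2x]×p^y≡1+2^[1+2x] : ∀ {p} x y z → Prime p → ¬ (2 ∣ p) →
  16 ^ x + p ^ y ≡ z ^ 2 → z ≡ 1 + 2 ^ (2 * x) × p ^ y ≡ 1 + 2 ^ (1 + 2 * x)
16^x+p^y≡z²⇒z≡1+2^[2x]×p^y≡1+2^[1+2x] {p} x y z pp 2∤p eq = z≡1+a , p^y≡1+2a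
  where
  a = 2 ^ (2 * x)
  squares : a * a + p ^ y ≡ z * z
  squares = trans (cong (_+ p ^ y) (sym (16^n≡2^[2n]*2^[2n] x))) (trans eq (cong (z *_) (*-identityʳ z)))
  p∤2a : ¬ (p ∣ 2 * a)
  p∤2a p∣2a = 2∤p (subst (2 ∣_) (sym (prime∣prime^⇒≡ (1 + 2 * x) prime[2] pp p∣2a)) ∣-refl)
  z≡1+a : z ≡ 1 + a
  z≡1+a = a²+p^y≡z²⇒z≡1+a a y z pp p∤2a squares
  expand : ∀ a → (1 + a) * (1 + a) ≡ a * a + (1 + 2 * a)
  expand = solve-∀
  p^y≡1+2a : p ^ y ≡ 1 + 2 * a
  p^y≡1+2a = +-cancelˡ-≡ (a * a) _ _ (trans squares (trans (cong (λ t → t * t) z≡1+a) (expand a)))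

3∣1+2^[1+2n] : ∀ n → 3 ∣ 1 + 2 ^ (1 + 2 * n)
3∣1+2^[1+2n] zero = ∣-refl
3∣1+2^[1+2n] (suc n) = subst (3 ∣_) (sym step) (∣m∣n⇒∣m+n (3∣1+2^[1+2n] n) (m∣m*n t))
  where
  t = 2 ^ (1 + 2 * n)
  exponent : ∀ n → 1 + 2 * suc n ≡ 2 + (1 + 2 * n)
  exponent = solve-∀
  regroup : ∀ t → 1 + 2 * (2 * t) ≡ (1 + t) + 3 * t
  regroup = solve-∀
  step : 1 + 2 ^ (1 + 2 * suc n) ≡ (1 + t) + 3 * t
  step = trans (cong (λ e → 1 + 2 ^ e) (exponent n)) (regroup t)

p^y≡1+2^[1+2x]⇒p≡3 : ∀ {p} y x → Prime p → p ^ y ≡ 1 + 2 ^ (1 + 2 * x) → p ≡ 3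
p^y≡1+2^[1+2x]⇒p≡3 y x pp eq =
  sym (prime∣prime^⇒≡ y pp prime[3] (subst (3 ∣_) (sym eq) (3∣1+2^[1+2n] x)))

%≡1⇒^%≡1 : ∀ {a m} .{{_ : NonZero m}} n → a % m ≡ 1 % m → a ^ n % m ≡ 1 % m
%≡1⇒^%≡1 zero _ = refl
%≡1⇒^%≡1 {a} {m} (suc n) a%m≡1 = begin
  (a * a ^ n) % m                 ≡⟨ %-distribˡ-* a (a ^ n) m ⟩
  ((a % m) * (a ^ n % m)) % m     ≡⟨ cong₂ (λ s t → (s * t) % m) a%m≡1 (%≡1⇒^%≡1 n a%m≡1) ⟩
  ((1 % m) * (1 % m)) % m         ≡⟨ %-distribˡ-* 1 1 m ⟨
  1 % m                           ∎

^%-period : ∀ a k n m .{{_ : NonZero k}} .{{_ : NonZero m}} →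
            a ^ k % m ≡ 1 % m → a ^ n % m ≡ a ^ (n % k) % m
^%-period a k n m a^k%m≡1 = begin
  a ^ n % m                                  ≡⟨ cong (λ e → a ^ e % m) (m≡m%n+[m/n]*n n k) ⟩
  a ^ (r + q * k) % m                        ≡⟨ cong (_% m) a^[r+qk] ⟩
  (a ^ r * (a ^ k) ^ q) % m                  ≡⟨ %-distribˡ-* (a ^ r) ((a ^ k) ^ q) m ⟩
  ((a ^ r % m) * ((a ^ k) ^ q % m)) % m      ≡⟨ cong (λ t → ((a ^ r % m) * t) % m) (%≡1⇒^%≡1 q a^k%m≡1) ⟩
  ((a ^ r % m) * (1 % m)) % m                ≡⟨ %-distribˡ-* (a ^ r) 1 m ⟨
  (a ^ r * 1) % m                            ≡⟨ cong (_% m) (*-identityʳ (a ^ r)) ⟩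
  a ^ r % m                                  ∎
  where
  r = n % k
  q = n / k
  a^[r+qk] : a ^ (r + q * k) ≡ a ^ r * (a ^ k) ^ q
  a^[r+qk] = trans (^-distribˡ-+-* a r (q * k))
                   (cong (a ^ r *_) (trans (cong (a ^_) (*-comm q k)) (sym (^-*-assoc a k q))))

-- 3 ^ 4 = 81 is ≡ 1 both modulo 16 and modulo 5, and 3 has order 4 modulo 16.
3^n%16≡1⇒3^n%5≡1 : ∀ n → 3 ^ n % 16 ≡ 1 → 3 ^ n % 5 ≡ 1
3^n%16≡1⇒3^n%5≡1 n 3^n%16≡1 = begin
  3 ^ n % 5          ≡⟨ ^%-period 3 4 n 5 refl ⟩
  3 ^ (n % 4) % 5    ≡⟨ cong (λ r → 3 ^ r % 5) n%4≡0 ⟩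
  1                  ∎
  where
  residue : ∀ r → r < 4 → 3 ^ r % 16 ≡ 1 → r ≡ 0
  residue 0 _ _ = refl
  residue 1 _ ()
  residue 2 _ ()
  residue 3 _ ()
  residue (suc (suc (suc (suc _)))) (s≤s (s≤s (s≤s (s≤s ())))) _
  n%4≡0 : n % 4 ≡ 0
  n%4≡0 = residue (n % 4) (m%n<n n 4) (trans (sym (^%-period 3 4 n 16 refl)) 3^n%16≡1)

3^n≢1+2^[4+m] : ∀ n m → 3 ^ n ≢ 1 + 2 ^ (4 + m)
3^n≢1+2^[4+m] n m eq = contradiction (prime∣prime^⇒≡ (4 + m) prime[2] prime[5] 5∣2^[4+m]) λ ()
  where
  times16 : ∀ t → 2 * (2 * (2 * (2 * t))) ≡ t * 16
  times16 = solve-∀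
  3^n%16≡1 : 3 ^ n % 16 ≡ 1
  3^n%16≡1 = begin
    3 ^ n % 16                ≡⟨ cong (_% 16) eq ⟩
    (1 + 2 ^ (4 + m)) % 16    ≡⟨ cong (λ t → (1 + t) % 16) (times16 (2 ^ m)) ⟩
    (1 + 2 ^ m * 16) % 16     ≡⟨ [m+kn]%n≡m%n 1 (2 ^ m) 16 ⟩
    1                         ∎
  5∣2^[4+m] : 5 ∣ 2 ^ (4 + m)
  5∣2^[4+m] = divides (3 ^ n / 5) (+-cancelˡ-≡ 1 _ _ (begin
    1 + 2 ^ (4 + m)            ≡⟨ eq ⟨
    3 ^ n                      ≡⟨ m≡m%n+[m/n]*n (3 ^ n) 5 ⟩
    3 ^ n % 5 + 3 ^ n / 5 * 5  ≡⟨ cong (_+ 3 ^ n / 5 * 5) (3^n%16≡1⇒3^n%5≡1 n 3^n%16≡1) ⟩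
    1 + 3 ^ n / 5 * 5          ∎))

^-injectiveʳ : ∀ m → 1 < m → ∀ {i j} → m ^ i ≡ m ^ j → i ≡ j
^-injectiveʳ m 1<m {i} {j} eq with <-cmp i j
... | tri< i<j _ _ = contradiction eq (<⇒≢ (^-monoʳ-< m 1<m i<j))
... | tri≈ _ i≡j _ = i≡j
... | tri> _ _ j<i = contradiction eq (>⇒≢ (^-monoʳ-< m 1<m j<i))

3^y≡1+2^[1+2x]-solutions : ∀ x y → 3 ^ y ≡ 1 + 2 ^ (1 + 2 * x) → (x ≡ 0 × y ≡ 1) ⊎ (x ≡ 1 × y ≡ 2)
3^y≡1+2^[1+2x]-solutions 0 y eq = inj₁ (refl , ^-injectiveʳ 3 (s≤s (s≤s z≤n)) eq)
3^y≡1+2^[1+2x]-solutions 1 y eq = inj₂ (refl , ^-injectiveʳ 3 (s≤s (s≤s z≤n)) eq)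
3^y≡1+2^[1+2x]-solutions (suc (suc x)) y eq =
  contradiction (trans eq (cong (λ e → 1 + 2 ^ e) (exponent x))) (3^n≢1+2^[4+m] y (1 + 2 * x))
  where
  exponent : ∀ x → 1 + 2 * (2 + x) ≡ 4 + (1 + 2 * x)
  exponent = solve-∀

Solution : ℕ → ℕ → ℕ → ℕ → Set
Solution p x y z = (p ≡ 3 × x ≡ 1 × y ≡ 2 × z ≡ 5)
  ⊎ (∃[ k ] (p ≡ 1 + 2 ^ (2 * k + 1) × x ≡ k × y ≡ 1 × z ≡ 2 ^ (2 * k) + 1))

solution⇒16^x+p^y≡z² : ∀ p x y z → Solution p x y z → 16 ^ x + p ^ y ≡ z ^ 2
solution⇒16^x+p^y≡z² .3 .1 .2 .5 (inj₁ (refl , refl , refl , refl)) = refl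
solution⇒16^x+p^y≡z² p x y z (inj₂ (k , refl , refl , refl , refl)) = begin
  16 ^ k + (1 + 2 ^ (2 * k + 1)) * 1
    ≡⟨ cong₂ (λ s t → s + (1 + t) * 1) (16^n≡2^[2n]*2^[2n] k) (^-distribˡ-+-* 2 (2 * k) 1) ⟩
  b * b + (1 + b * 2) * 1
    ≡⟨ identity b ⟩
  (b + 1) ^ 2 ∎
  where
  b = 2 ^ (2 * k)
  identity : ∀ b → b * b + (1 + b * 2) * 1 ≡ (b + 1) * ((b + 1) * 1)
  identity = solve-∀

theorem2 : (p : ℕ) → Prime p → ¬ (2 ∣ p) → (x y z : ℕ) →
    ((16 ^ x) + (p ^ y) ≡ z ^ 2) ⇔
    ((p ≡ 3 × x ≡ 1 × y ≡ 2 × z ≡ 5)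
    ⊎ (∃[ k ] (p ≡ 1 + 2 ^ (2 * k + 1) × x ≡ k × y ≡ 1 × z ≡ 2 ^ (2 * k) + 1)))
theorem2 p pp 2∤p x y z = mk⇔ solutions (solution⇒16^x+p^y≡z² p x y z)
  where
  solutions : 16 ^ x + p ^ y ≡ z ^ 2 → Solution p x y z
  solutions eq with 16^x+p^y≡z²⇒z≡1+2^[2x]×p^y≡1+2^[1+2x] x y z pp 2∤p eq
  ... | z≡1+a , p^y≡1+2a with p^y≡1+2^[1+2x]⇒p≡3 y x pp p^y≡1+2a
  ...   | refl with 3^y≡1+2^[1+2x]-solutions x y p^y≡1+2a
  ...     | inj₁ (refl , refl) = inj₂ (0 , refl , refl , refl , z≡1+a)
  ...     | inj₂ (refl , refl) = inj₁ (refl , refl , refl , z≡1+a)
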